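{- Let $G_4$ be the graph with vertices $x,y,u_0,u_1,v_0,v_1,w$ and edges $xu_1,u_1u_0,u_1v_0,u_0v_1,u_0w,v_0v_1,v_0w,v_1y$. If $\varphi$ is a conflict-free incidence coloring of $G_4$ using at most $6$ colors, then $\{\varphi(u_1,u_1x),\varphi(x,u_1x)\}\cap\{\varphi(v_1,v_1y),\varphi(y,v_1y)\}=\emptyset$.
   Context: An incidence of a graph is a pair $(a,e)$ with $a$ an endpoint of the edge $e$; for a vertex $c$, $I(c)$ is the set of incidences $(b,e)$ with $e$ incident with $c$; two incidences conflict if both lie in some $I(c)$; a conflict-free incidence coloring assigns colors to incidences so that conflicting incidences get distinct colors. -}

module Defs where

open import Data.Fin using (Fin)
open import Data.Product using (Σ; _×_; ∃)
open import Relation.Binary.PropositionalEquality using (_≡_; _≢_)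

data V : Set where
  x y u₀ u₁ v₀ v₁ w : V

data E : Set where
  xu₁ u₁u₀ u₁v₀ u₀v₁ u₀w v₀v₁ v₀w v₁y : E

data End : V → E → Set where
  xu₁-x : End x xu₁
  xu₁-u₁ : End u₁ xu₁
  u₁u₀-u₁ : End u₁ u₁u₀
  u₁u₀-u₀ : End u₀ u₁u₀
  u₁v₀-u₁ : End u₁ u₁v₀
  u₁v₀-v₀ : End v₀ u₁v₀
  u₀v₁-u₀ : End u₀ u₀v₁
  u₀v₁-v₁ : End v₁ u₀v₁
  u₀w-u₀ : End u₀ u₀w
  u₀w-w : End w u₀w
  v₀v₁-v₀ : End v₀ v₀v₁
  v₀v₁-v₁ : End v₁ v₀v₁
  v₀w-v₀ : End v₀ v₀w
  v₀w-w : End w v₀w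
  v₁y-v₁ : End v₁ v₁y
  v₁y-y : End y v₁y

record Incidence : Set where
  constructor inc
  field
    vertex : V
    edge   : E
    isEnd  : End vertex edge
open Incidence public

-- i ∈ I(c) : the edge of i is incident with c
InI : V → Incidence → Set
InI c i = End c (edge i)

Conflict : Incidence → Incidence → Set
Conflict i j = ∃ λ c → InI c i × InI c j

ConflictFree : {C : Set} → (Incidence → C) → Set
ConflictFree φ = ∀ i j → i ≢ j → Conflict i j → φ i ≢ φ j

module Submission where

open import Defs
open import Data.Fin using (Fin; zero; suc; _≟_)
open import Data.Fin.Properties using (any?; all?; injective⇒≤)
open import Data.Nat using (ℕ; suc)
open import Data.Nat.Properties using (1+n≰n)
open import Data.Vec using ([]; _∷_; lookup)
open import Data.Sum using (_⊎_; inj₁; inj₂)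
open import Data.Product using (Σ; ∃; _×_; _,_; proj₁; proj₂)
open import Data.Empty using (⊥; ⊥-elim)
open import Function using (_∘_)
open import Function.Definitions using (Injective; StrictlySurjective)
open import Function.Consequences.Propositional using (inverseʳ⇒injective; strictlyInverseʳ⇒inverseʳ)
open import Relation.Nullary using (¬_; yes; no; contradiction)
open import Relation.Nullary.Decidable using (from-yes)
open import Relation.Binary.PropositionalEquality using (_≡_; _≢_; refl; sym; trans; cong; subst)

-- A colour k common to the edges xu₁ and v₁y is excluded from every other edge at u₁ and at v₁.
-- The six incidences at u₀ pairwise conflict, so with six colours they use every colour; since
-- u₀'s other neighbours are u₁ and v₁, colour k occurs on the edge u₀w. Likewise it occurs on
-- v₀w, and these two incidences conflict at w.

private
  variable
    n : ℕ
    c : V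
    e : E
    i j : Incidence

injective⇒strictlySurjective : {f : Fin n → Fin n} → Injective _≡_ _≡_ f → StrictlySurjective _≡_ f
injective⇒strictlySurjective {n} {f} f-injective k with any? (λ a → f a ≟ k)
... | yes hit = hit
... | no miss = contradiction (injective⇒≤ extend-injective) 1+n≰n
  where
  extend : Fin (suc n) → Fin n
  extend zero = k
  extend (suc a) = f a

  extend-injective : Injective _≡_ _≡_ extend
  extend-injective {zero}  {zero}  _     = refl
  extend-injective {zero}  {suc b} k≡fb  = contradiction (b , sym k≡fb) miss
  extend-injective {suc a} {zero}  fa≡k  = contradiction (a , fa≡k) miss
  extend-injective {suc a} {suc b} fa≡fb = cong suc (f-injective fa≡fb)

module _ {C : Set} {φ : Incidence → C} (φ-cf : ConflictFree φ) where

  distinct-edges⇒distinct-colours : InI c i → InI c j → edge i ≢ edge j → φ i ≢ φ j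
  distinct-edges⇒distinct-colours {c} c∈i c∈j i≢j = φ-cf _ _ (i≢j ∘ cong edge) (c , c∈i , c∈j)

  colour-on-edge-excluded : ∀ {a b p q k} → End c e → (k ≡ φ (inc a e p) ⊎ k ≡ φ (inc b e q)) →
                            InI c i → edge i ≢ e → φ i ≢ k
  colour-on-edge-excluded c∈e (inj₁ k≡φa) c∈i i≢e φi≡k =
    distinct-edges⇒distinct-colours c∈i c∈e i≢e (trans φi≡k k≡φa)
  colour-on-edge-excluded c∈e (inj₂ k≡φb) c∈i i≢e φi≡k =
    distinct-edges⇒distinct-colours c∈i c∈e i≢e (trans φi≡k k≡φb)

  colours-injective-on-star : {m : ℕ} (s : Fin m → Incidence) → Injective _≡_ _≡_ s →
                              (∀ a → InI c (s a)) → Injective _≡_ _≡_ (φ ∘ s)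
  colours-injective-on-star {c} s s-injective s-in {a} {b} φsa≡φsb with a ≟ b
  ... | yes a≡b = a≡b
  ... | no  a≢b = contradiction φsa≡φsb (φ-cf _ _ (a≢b ∘ s-injective) (c , s-in a , s-in b))

every-colour-occurs : {φ : Incidence → Fin n} → ConflictFree φ →
                      (s : Fin n → Incidence) → Injective _≡_ _≡_ s → (∀ a → InI c (s a)) →
                      ∀ k → ∃ λ i → InI c i × φ i ≡ k
every-colour-occurs φ-cf s s-injective s-in k =
  let a , φsa≡k = injective⇒strictlySurjective (colours-injective-on-star φ-cf s s-injective s-in) k
  in s a , s-in a , φsa≡k

star-u₀ : Fin 6 → Σ Incidence (InI u₀)
star-u₀ = lookup
  ( (inc u₁ u₁u₀ u₁u₀-u₁ , u₁u₀-u₀) ∷ (inc u₀ u₁u₀ u₁u₀-u₀ , u₁u₀-u₀)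
  ∷ (inc u₀ u₀v₁ u₀v₁-u₀ , u₀v₁-u₀) ∷ (inc v₁ u₀v₁ u₀v₁-v₁ , u₀v₁-u₀)
  ∷ (inc u₀ u₀w u₀w-u₀ , u₀w-u₀)   ∷ (inc w u₀w u₀w-w , u₀w-u₀)     ∷ [])

star-u₀-index : Incidence → Fin 6
star-u₀-index (inc _ _ u₁u₀-u₀) = suc zero
star-u₀-index (inc _ _ u₀v₁-u₀) = suc (suc zero)
star-u₀-index (inc _ _ u₀v₁-v₁) = suc (suc (suc zero))
star-u₀-index (inc _ _ u₀w-u₀)  = suc (suc (suc (suc zero)))
star-u₀-index (inc _ _ u₀w-w)   = suc (suc (suc (suc (suc zero))))
star-u₀-index _                 = zero

star-u₀-injective : Injective _≡_ _≡_ (proj₁ ∘ star-u₀)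
star-u₀-injective = inverseʳ⇒injective (proj₁ ∘ star-u₀)
  (strictlyInverseʳ⇒inverseʳ {f⁻¹ = star-u₀-index} (proj₁ ∘ star-u₀)
    (from-yes (all? λ a → star-u₀-index (proj₁ (star-u₀ a)) ≟ a)))

star-v₀ : Fin 6 → Σ Incidence (InI v₀)
star-v₀ = lookup
  ( (inc u₁ u₁v₀ u₁v₀-u₁ , u₁v₀-v₀) ∷ (inc v₀ u₁v₀ u₁v₀-v₀ , u₁v₀-v₀)
  ∷ (inc v₀ v₀v₁ v₀v₁-v₀ , v₀v₁-v₀) ∷ (inc v₁ v₀v₁ v₀v₁-v₁ , v₀v₁-v₀)
  ∷ (inc v₀ v₀w v₀w-v₀ , v₀w-v₀)   ∷ (inc w v₀w v₀w-w , v₀w-v₀)     ∷ [])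

star-v₀-index : Incidence → Fin 6
star-v₀-index (inc _ _ u₁v₀-v₀) = suc zero
star-v₀-index (inc _ _ v₀v₁-v₀) = suc (suc zero)
star-v₀-index (inc _ _ v₀v₁-v₁) = suc (suc (suc zero))
star-v₀-index (inc _ _ v₀w-v₀)  = suc (suc (suc (suc zero)))
star-v₀-index (inc _ _ v₀w-w)   = suc (suc (suc (suc (suc zero))))
star-v₀-index _                 = zero

star-v₀-injective : Injective _≡_ _≡_ (proj₁ ∘ star-v₀)
star-v₀-injective = inverseʳ⇒injective (proj₁ ∘ star-v₀)
  (strictlyInverseʳ⇒inverseʳ {f⁻¹ = star-v₀-index} (proj₁ ∘ star-v₀)
    (from-yes (all? λ a → star-v₀-index (proj₁ (star-v₀ a)) ≟ a)))

u₀-v₀-nonadjacent : End u₀ e → ¬ End v₀ e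
u₀-v₀-nonadjacent u₁u₀-u₀ ()
u₀-v₀-nonadjacent u₀v₁-u₀ ()
u₀-v₀-nonadjacent u₀w-u₀ ()

module _ {φ : Incidence → Fin 6} (φ-cf : ConflictFree φ) {k : Fin 6}
         (k∈xu₁ : k ≡ φ (inc u₁ xu₁ xu₁-u₁) ⊎ k ≡ φ (inc x xu₁ xu₁-x))
         (k∈v₁y : k ≡ φ (inc v₁ v₁y v₁y-v₁) ⊎ k ≡ φ (inc y v₁y v₁y-y)) where

  colour-at-u₀-lies-at-w : InI u₀ i → φ i ≡ k → InI w i
  colour-at-u₀-lies-at-w {inc _ _ _} u₁u₀-u₀ = ⊥-elim ∘ colour-on-edge-excluded φ-cf xu₁-u₁ k∈xu₁ u₁u₀-u₁ (λ ())
  colour-at-u₀-lies-at-w {inc _ _ _} u₀v₁-u₀ = ⊥-elim ∘ colour-on-edge-excluded φ-cf v₁y-v₁ k∈v₁y u₀v₁-v₁ (λ ())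
  colour-at-u₀-lies-at-w {inc _ _ _} u₀w-u₀ _ = u₀w-w

  colour-at-v₀-lies-at-w : InI v₀ i → φ i ≡ k → InI w i
  colour-at-v₀-lies-at-w {inc _ _ _} u₁v₀-v₀ = ⊥-elim ∘ colour-on-edge-excluded φ-cf xu₁-u₁ k∈xu₁ u₁v₀-u₁ (λ ())
  colour-at-v₀-lies-at-w {inc _ _ _} v₀v₁-v₀ = ⊥-elim ∘ colour-on-edge-excluded φ-cf v₁y-v₁ k∈v₁y v₀v₁-v₁ (λ ())
  colour-at-v₀-lies-at-w {inc _ _ _} v₀w-v₀ _ = v₀w-w

lemma3p5 : (φ : Incidence → Fin 6) → ConflictFree φ →
    (k : Fin 6) →
    (k ≡ φ (inc u₁ xu₁ xu₁-u₁) ⊎ k ≡ φ (inc x xu₁ xu₁-x)) →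
    (k ≡ φ (inc v₁ v₁y v₁y-v₁) ⊎ k ≡ φ (inc y v₁y v₁y-y)) → ⊥
lemma3p5 φ φ-cf k k∈xu₁ k∈v₁y =
  let i , i∈u₀ , φi≡k = every-colour-occurs φ-cf (proj₁ ∘ star-u₀) star-u₀-injective (proj₂ ∘ star-u₀) k
      j , j∈v₀ , φj≡k = every-colour-occurs φ-cf (proj₁ ∘ star-v₀) star-v₀-injective (proj₂ ∘ star-v₀) k
  in distinct-edges⇒distinct-colours φ-cf
       (colour-at-u₀-lies-at-w φ-cf k∈xu₁ k∈v₁y i∈u₀ φi≡k)
       (colour-at-v₀-lies-at-w φ-cf k∈xu₁ k∈v₁y j∈v₀ φj≡k)
       (λ eᵢ≡eⱼ → u₀-v₀-nonadjacent (subst (End u₀) eᵢ≡eⱼ i∈u₀) j∈v₀)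
       (trans φi≡k (sym φj≡k))
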